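{- Let $n\ge 1$, let $D\in\mathcal{D}_n$ with area sequence $\mathrm{areaseq}(D)=(a_1,\ldots,a_n)$, and let $T$ be the planted tree on vertex set $\{0,\ldots,n\}$ associated with $(a_1,\ldots,a_n)$. Then: (1) the number of children of the root of $T$ equals the number of indices $j$ with $a_j=0$; (2) the number of crucial non-root vertices of $T$ equals the number of integers $i\ge 0$ such that $i+1$ occurs in $(a_1,\ldots,a_n)$ and every occurrence of $i$ in $(a_1,\ldots,a_n)$ lies to the left of every occurrence of $i+1$. In particular, $(a_1,\ldots,a_n)$ satisfies Property (C) if and only if the root $0$ is the unique crucial vertex of $T$.
   Context: A Dyck path $D\in\mathcal{D}_n$ is a sequence of $n$ north steps and $n$ east steps such that every prefix has no more east than north steps. Its area sequence is $\mathrm{areaseq}(D)=(a_1,\ldots,a_n)$ with $a_i=i-x_i-1$, where $x_i$ is the number of east steps before the $i$-th north step. The area sequences are exactly the sequences of nonnegative integers with $a_1=0$ and $a_{i+1}\le a_i+1$. A sequence $(a_1,\ldots,a_n)$ satisfies Property (C) if $a_1=0$, $a_{i+1}\le a_i+1$ for all $i$, and whenever $a_i=k>0$ with $i$ minimal (leftmost occurrence of $k$), there exists $i_2>i$ with $a_{i_2}=k-1$. A planted tree is a rooted tree in which the children of each vertex are linearly ordered. To an area sequence $(a_1,\ldots,a_n)$ one associates the planted tree on $\{0,\ldots,n\}$ with root $0$ placed in generation $-1$, where each vertex $i>0$ lies in generation $a_i$ and its parent is the largest $j<i$ with $a_j=a_i-1$ (with $j=0$ if $a_i=0$); children of a vertex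 are ordered by increasing label. The generation of a vertex is its depth minus one. Within a generation, vertices are ordered by birth order, which is the order in which they are visited by the depth-first preorder traversal of the planted tree (children visited in their linear order); the youngest member of a generation is the last one in this order. A vertex $v$ is crucial if $v$ is the youngest member of its generation, $v$ has at least one child, and all other members of its generation have no children. -}

module Defs where

open import Data.Nat using (ℕ; zero; suc; _+_; _∸_; _≤_; _<_; _≟_; _<?_; _⊔_; pred)
open import Data.Integer as ℤ using (ℤ; +_; -[1+_])
open import Data.List using (List; []; _∷_; length; filter; upTo; map; concatMap; last; take; foldr)
open import Data.List.Relation.Unary.All as All using (All)
open import Data.List.Relation.Unary.Any as Any using (Any)
open import Data.Maybe using (Maybe; just; nothing)
import Data.Maybe.Properties as MaybeP
import Data.List.Properties as ListP
open import Data.Product using (_×_; Σ; ∃)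
open import Relation.Binary.PropositionalEquality using (_≡_; _≢_)
open import Relation.Nullary using (Dec; yes; no; ¬_; does)
open import Relation.Nullary.Decidable using (_×-dec_; _→-dec_; ¬?)

data Step : Set where
  N E : Step

#N : List Step → ℕ
#N []       = 0
#N (N ∷ w) = suc (#N w)
#N (E ∷ w) = #N w

#E : List Step → ℕ
#E []       = 0
#E (N ∷ w) = #E w
#E (E ∷ w) = suc (#E w)

IsDyck : ℕ → List Step → Set
IsDyck n w = (#N w ≡ n) × (#E w ≡ n) × (∀ k → #E (take k w) ≤ #N (take k w))

-- area sequence: a_i = i - x_i - 1, where x_i = #E steps before the i-th N step.
-- The helper carries (number of N steps seen so far, number of E steps so far);
-- at the i-th N step we have seen i-1 N steps, so a_i = (i - 1) - x_i.
areaseqFrom : ℕ → ℕ → List Step → List ℕ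
areaseqFrom i x []       = []
areaseqFrom i x (N ∷ w) = (i ∸ x) ∷ areaseqFrom (suc i) x w
areaseqFrom i x (E ∷ w) = areaseqFrom i (suc x) w

areaseq : List Step → List ℕ
areaseq = areaseqFrom 0 0

-- Sequences, 1-indexed: at as i = a_i for 1 ≤ i ≤ length as (0 otherwise)

at : List ℕ → ℕ → ℕ
at []           _             = 0
at (x ∷ xs)    zero          = 0
at (x ∷ xs)    (suc zero)    = x
at (x ∷ xs)    (suc (suc i)) = at xs (suc i)

positions : ℕ → List ℕ
positions n = map suc (upTo n)

vertices : List ℕ → List ℕ
vertices as = upTo (suc (length as))

lastWith : List ℕ → ℕ → ℕ → Maybe ℕ
lastWith as k zero    = nothing
lastWith as k (suc m) with at as (suc m) ≟ k
... | yes _ = just (suc m)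
... | no  _ = lastWith as k m

parent : List ℕ → ℕ → Maybe ℕ
parent as zero    = nothing
parent as (suc i) with at as (suc i)
... | zero  = just 0
... | suc k = lastWith as k i

children : List ℕ → ℕ → List ℕ
children as v = filter (λ w → MaybeP.≡-dec _≟_ (parent as w) (just v)) (vertices as)

generation : List ℕ → ℕ → ℤ
generation as zero    = -[1+ 0 ]
generation as (suc i) = + at as (suc i)

-- depth-first preorder traversal (children in their linear order), with fuel;
-- the tree has depth ≤ n, so fuel suc n visits the whole tree.
preorderF : List ℕ → ℕ → ℕ → List ℕ
preorderF as zero    v = []
preorderF as (suc f) v = v ∷ concatMap (preorderF as f) (children as v)

birthOrder : List ℕ → List ℕ
birthOrder as = preorderF as (suc (length as)) 0

generationMembers : List ℕ → ℕ → List ℕ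
generationMembers as v =
  filter (λ w → generation as w ℤ.≟ generation as v) (birthOrder as)

Youngest : List ℕ → ℕ → Set
Youngest as v = last (generationMembers as v) ≡ just v

Crucial : List ℕ → ℕ → Set
Crucial as v =
  Youngest as v
  × (0 < length (children as v))
  × All (λ w → w ≢ v → generation as w ≡ generation as v → children as w ≡ [])
        (vertices as)

crucial? : (as : List ℕ) → (v : ℕ) → Dec (Crucial as v)
crucial? as v =
  MaybeP.≡-dec _≟_ (last (generationMembers as v)) (just v)
  ×-dec (0 <? length (children as v))
  ×-dec All.all? (λ w → ¬? (w ≟ v) →-dec ((generation as w ℤ.≟ generation as v)
                   →-dec ListP.≡-dec _≟_ (children as w) [])) (vertices as)

numCrucialNonRoot : List ℕ → ℕ
numCrucialNonRoot as = length (filter (crucial? as) (positions (length as)))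

RootUniqueCrucial : List ℕ → Set
RootUniqueCrucial as = Crucial as 0 × All (λ v → Crucial as v → v ≡ 0) (vertices as)

numZeros : List ℕ → ℕ
numZeros as = length (filter (λ x → x ≟ 0) as)

Separated : List ℕ → ℕ → Set
Separated as i =
  Any (λ x → x ≡ suc i) as
  × All (λ j → All (λ k → at as j ≡ i → at as k ≡ suc i → j < k)
                   (positions (length as)))
        (positions (length as))

separated? : (as : List ℕ) → (i : ℕ) → Dec (Separated as i)
separated? as i =
  Any.any? (λ x → x ≟ suc i) as
  ×-dec All.all? (λ j → All.all? (λ k → (at as j ≟ i) →-dec ((at as k ≟ suc i) →-dec (j <? k)))
                   (positions (length as)))
        (positions (length as))

-- maximum entry of the sequence; any i with i+1 occurring satisfies i < maxEntry,
-- so counting i over upTo (maxEntry as) counts all integers i ≥ 0 with the property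
maxEntry : List ℕ → ℕ
maxEntry = foldr _⊔_ 0

numSeparated : List ℕ → ℕ
numSeparated as = length (filter (separated? as) (upTo (maxEntry as)))

PropertyC : List ℕ → Set
PropertyC as =
  (at as 1 ≡ 0)
  × (∀ i → 1 ≤ i → suc i ≤ length as → at as (suc i) ≤ suc (at as i))
  × (∀ i → 1 ≤ i → i ≤ length as → 0 < at as i
       → (∀ j → 1 ≤ j → j < i → at as j ≢ at as i)
       → ∃ λ i₂ → i < i₂ × i₂ ≤ length as × at as i₂ ≡ pred (at as i))

module Submission where

-- Write ℓ v for the generation of v plus one, so ℓ 0 = 0 and ℓ i = aᵢ + 1.  Everything
-- rests on the shape of area sequences (a₁ = 0 and a_{i+1} ≤ aᵢ + 1):
--  * ℓ climbs by at most one per step, so it attains every intermediate value on the way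
--    up (climb); hence the parent of u is the latest earlier vertex one level above u
--    (parent-sound, parent-complete), and every value k+1 is preceded by a k;
--  * the subtree of v occupies the labels from v up to the next vertex no deeper than v
--    (SubtreeSpan, child-block), so preorder lists the vertices by label
--    (birthOrder≡vertices) and the youngest member of a generation is its largest label;
--  * hence a non-root vertex v is crucial iff it is the last occurrence of its entry aᵥ
--    and aᵥ is separated (crucial⇒, crucial⇐).
-- Part (1) identifies the children of the root with the positions holding 0; part (2)
-- counts crucial vertices by their entries, each separated value contributing exactly its
-- last occurrence (count-by-fibres); part (3) reads Property (C) through the same
-- characterization.

open import Defs
open import Data.Nat using (ℕ; _≤_)
open import Data.List using (List; length)
open import Data.Product using (_×_)
open import Function.Bundles using (_⇔_)
open import Relation.Binary.PropositionalEquality using (_≡_)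

open import Data.Nat using (zero; suc; _+_; _∸_; _<_; _≟_; _<?_; _≤?_; z≤n; s≤s; z<s; s<s; pred)
open import Data.Nat.Properties
open import Data.Nat.Induction using (<-wellFounded)
open import Induction.WellFounded using (Acc; acc)
open import Data.List using ([]; _∷_; [_]; _++_; filter; upTo; applyUpTo; map; concatMap; last)
open import Data.List.Properties
  using (filter-++; filter-none; filter-accept; filter-reject; filter-some; filter-≐;
         length-++; ++-identityʳ; upTo-∷ʳ)
open import Data.List.Membership.Propositional using (_∈_; lose)
open import Data.List.Membership.Propositional.Properties using (∈-filter⁺; ∈-filter⁻; ∈-upTo⁺; ∈-upTo⁻)
open import Data.List.Relation.Unary.All as All using (All; []; _∷_)
open import Data.List.Relation.Unary.Any using (Any; here; there)
open import Data.List.Relation.Unary.Any.Properties using (¬Any[])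
open import Data.Maybe using (just)
import Data.Maybe.Properties as MaybeP
import Data.Integer as ℤ
import Data.Integer.Properties as ℤ
open import Data.Product using (∃; _,_; proj₁; proj₂)
open import Data.Sum using (_⊎_; inj₁; inj₂)
open import Data.Empty using (⊥; ⊥-elim)
open import Data.Unit using (⊤; tt)
open import Function using (_∘_)
open import Function.Bundles using (Equivalence; mk⇔)
open import Relation.Binary.PropositionalEquality using (refl; sym; trans; cong; cong₂; subst; _≢_; module ≡-Reasoning)
open import Relation.Binary.Definitions using (tri<; tri≈; tri>)
open import Relation.Nullary using (yes; no; ¬_)
open import Relation.Nullary.Decidable using (_×-dec_; _⊎-dec_)
open import Relation.Unary using (Pred; Decidable)
open import Relation.Unary.Properties using (_∩?_; _∪?_)

open Equivalence using (to; from)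
open ≡-Reasoning

interval : ℕ → ℕ → List ℕ
interval a zero    = []
interval a (suc k) = a ∷ interval (suc a) k

below-next : ∀ {a k w} → w < a + suc k → w < a + k ⊎ w ≡ a + k
below-next {a} {k} {w} w< = m≤n⇒m<n∨m≡n (≤-pred (subst (w <_) (+-suc a k) w<))

∈-interval⁺ : ∀ {a k w} → a ≤ w → w < a + k → w ∈ interval a k
∈-interval⁺ {a} {zero}  {w} a≤w w< = ⊥-elim (<⇒≱ (subst (w <_) (+-identityʳ a) w<) a≤w)
∈-interval⁺ {a} {suc k} {w} a≤w w< with m≤n⇒m<n∨m≡n a≤w
... | inj₂ refl = here refl
... | inj₁ a<w  = there (∈-interval⁺ a<w (subst (w <_) (+-suc a k) w<))

∈-interval⁻ : ∀ {a k w} → w ∈ interval a k → a ≤ w × w < a + k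
∈-interval⁻ {a} {suc k} (here refl) = ≤-refl , m<m+n a z<s
∈-interval⁻ {a} {suc k} {w} (there w∈) with ∈-interval⁻ w∈
... | a<w , w< = <⇒≤ a<w , subst (w <_) (sym (+-suc a k)) w<

All-interval⁺ : ∀ {p} {P : Pred ℕ p} {a k} → (∀ w → a ≤ w → w < a + k → P w) → All P (interval a k)
All-interval⁺ h = All.tabulate (λ w∈ → h _ (proj₁ (∈-interval⁻ w∈)) (proj₂ (∈-interval⁻ w∈)))

All-interval⁻ : ∀ {p} {P : Pred ℕ p} {a k} → All P (interval a k) → ∀ w → a ≤ w → w < a + k → P w
All-interval⁻ ps w a≤w w< = All.lookup ps (∈-interval⁺ a≤w w<)

interval-++ : ∀ a k l → interval a (k + l) ≡ interval a k ++ interval (a + k) l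
interval-++ a zero    l = cong (λ b → interval b l) (sym (+-identityʳ a))
interval-++ a (suc k) l = cong (a ∷_) (trans (interval-++ (suc a) k l)
                                             (cong (λ b → interval (suc a) k ++ interval b l) (sym (+-suc a k))))

interval-∷ʳ : ∀ a k → interval a (suc k) ≡ interval a k ++ [ a + k ]
interval-∷ʳ a k = trans (cong (interval a) (+-comm 1 k)) (interval-++ a k 1)

upTo≡interval : ∀ m → upTo m ≡ interval 0 m
upTo≡interval m = shifted (λ i → i) 0 m (λ i → refl)
  where
  shifted : ∀ (f : ℕ → ℕ) a k → (∀ i → f i ≡ a + i) → applyUpTo f k ≡ interval a k
  shifted f a zero    f≡ = refl
  shifted f a (suc k) f≡ = cong₂ _∷_ (trans (f≡ 0) (+-identityʳ a))
    (shifted (f ∘ suc) (suc a) k (λ i → trans (f≡ (suc i)) (+-suc a i)))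

map-suc-interval : ∀ a k → map suc (interval a k) ≡ interval (suc a) k
map-suc-interval a zero    = refl
map-suc-interval a (suc k) = cong (suc a ∷_) (map-suc-interval (suc a) k)

positions≡interval : ∀ m → positions m ≡ interval 1 m
positions≡interval m = trans (cong (map suc) (upTo≡interval m)) (map-suc-interval 0 m)

All-positions⁺ : ∀ {p} {P : Pred ℕ p} m → (∀ w → 1 ≤ w → w ≤ m → P w) → All P (positions m)
All-positions⁺ m h = subst (All _) (sym (positions≡interval m)) (All-interval⁺ (λ w 1≤w w< → h w 1≤w (≤-pred w<)))

All-positions⁻ : ∀ {p} {P : Pred ℕ p} m → All P (positions m) → ∀ w → 1 ≤ w → w ≤ m → P w
All-positions⁻ m ps w 1≤w w≤m = All-interval⁻ (subst (All _) (positions≡interval m) ps) w 1≤w (s≤s w≤m)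

last-∷ʳ : ∀ {a} {A : Set a} (xs : List A) y → last (xs ++ [ y ]) ≡ just y
last-∷ʳ []            y = refl
last-∷ʳ (x ∷ [])      y = refl
last-∷ʳ (x ∷ x′ ∷ xs) y = last-∷ʳ (x′ ∷ xs) y

module _ {a p q} {A : Set a} {P : Pred A p} {Q : Pred A q} (P? : Decidable P) (Q? : Decidable Q) where

  filter-cong-on : ∀ {xs} → All (λ x → P x ⇔ Q x) xs → filter P? xs ≡ filter Q? xs
  filter-cong-on {[]}     []       = refl
  filter-cong-on {x ∷ xs} (e ∷ es) with P? x
  ... | yes px = trans (cong (x ∷_) (filter-cong-on es)) (sym (filter-accept Q? (to e px)))
  ... | no ¬px = trans (filter-cong-on es) (sym (filter-reject Q? (¬px ∘ from e)))

  length-filter-∪ : (∀ x → P x → Q x → ⊥) → ∀ xs →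
    length (filter (P? ∪? Q?) xs) ≡ length (filter P? xs) + length (filter Q? xs)
  length-filter-∪ disjoint []       = refl
  length-filter-∪ disjoint (x ∷ xs) with P? x | Q? x
  ... | yes px | yes qx = ⊥-elim (disjoint x px qx)
  ... | yes _  | no _   = cong suc (length-filter-∪ disjoint xs)
  ... | no _   | yes _  = trans (cong suc (length-filter-∪ disjoint xs)) (sym (+-suc _ _))
  ... | no _   | no _   = length-filter-∪ disjoint xs

length-filter-map : ∀ {a b p} {A : Set a} {B : Set b} {P : Pred B p} (P? : Decidable P) (f : A → B) xs →
  length (filter P? (map f xs)) ≡ length (filter (P? ∘ f) xs)
length-filter-map P? f []       = refl
length-filter-map P? f (x ∷ xs) with P? (f x)
... | yes _ = cong suc (length-filter-map P? f xs)
... | no _  = length-filter-map P? f xs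

count-by-fibres : ∀ {a p q} {A : Set a} {P : Pred A p} {Q : Pred ℕ q}
  (P? : Decidable P) (Q? : Decidable Q) (f : A → ℕ) xs →
  (∀ k → length (filter (P? ∩? (λ x → f x ≟ k)) xs) ≡ length (filter Q? [ k ])) →
  ∀ K → length (filter (P? ∩? (λ x → f x <? K)) xs) ≡ length (filter Q? (upTo K))
count-by-fibres {P = P} P? Q? f xs fibre zero =
  cong length (filter-none (P? ∩? (λ x → f x <? 0)) (All.universal (λ { x (_ , ()) }) xs))
count-by-fibres {P = P} P? Q? f xs fibre (suc K) = begin
  length (filter (P? ∩? (λ x → f x <? suc K)) xs)
    ≡⟨ cong length (filter-≐ (P? ∩? (λ x → f x <? suc K)) (below? ∪? at?) (split , merge) xs) ⟩
  length (filter (below? ∪? at?) xs)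
    ≡⟨ length-filter-∪ below? at? (λ { x (_ , lt) (_ , refl) → <-irrefl refl lt }) xs ⟩
  length (filter below? xs) + length (filter at? xs)
    ≡⟨ cong₂ _+_ (count-by-fibres P? Q? f xs fibre K) (fibre K) ⟩
  length (filter Q? (upTo K)) + length (filter Q? [ K ])
    ≡⟨ sym (length-++ (filter Q? (upTo K))) ⟩
  length (filter Q? (upTo K) ++ filter Q? [ K ])
    ≡⟨ cong length (sym (filter-++ Q? (upTo K) [ K ])) ⟩
  length (filter Q? (upTo K ++ [ K ]))
    ≡⟨ cong (length ∘ filter Q?) (upTo-∷ʳ K) ⟩
  length (filter Q? (upTo (suc K))) ∎
  where
  below? = P? ∩? (λ x → f x <? K)
  at?    = P? ∩? (λ x → f x ≟ K)
  split : ∀ {x} → P x × f x < suc K → (P x × f x < K) ⊎ (P x × f x ≡ K)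
  split (px , lt) with m≤n⇒m<n∨m≡n (≤-pred lt)
  ... | inj₁ f<K = inj₁ (px , f<K)
  ... | inj₂ f≡K = inj₂ (px , f≡K)
  merge : ∀ {x} → (P x × f x < K) ⊎ (P x × f x ≡ K) → P x × f x < suc K
  merge (inj₁ (px , f<K))  = px , m<n⇒m<1+n f<K
  merge (inj₂ (px , refl)) = px , n<1+n _

count-in-interval : ∀ a k c → a ≤ c → c < a + k → length (filter (_≟ c) (interval a k)) ≡ 1
count-in-interval a zero    c a≤c c< = ⊥-elim (<⇒≱ (subst (c <_) (+-identityʳ a) c<) a≤c)
count-in-interval a (suc k) c a≤c c< with m≤n⇒m<n∨m≡n a≤c
... | inj₂ refl = trans (cong length (filter-accept (_≟ a) refl))
                        (cong (suc ∘ length) (filter-none (_≟ a) (All-interval⁺ {a = suc a} {k = k} (λ w a<w _ → >⇒≢ a<w))))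
... | inj₁ a<c  = trans (cong length (filter-reject (_≟ c) (<⇒≢ a<c)))
                        (count-in-interval (suc a) k c a<c (subst (c <_) (+-suc a k) c<))

filter-middle : ∀ {p} {P : Pred ℕ p} (P? : Decidable P) a k l m →
  (∀ w → a ≤ w → w < a + k → ¬ P w) → (∀ w → a + k + l ≤ w → w < a + k + l + m → ¬ P w) →
  filter P? (interval a (k + l + m)) ≡ filter P? (interval (a + k) l)
filter-middle P? a k l m before after = begin
  filter P? (interval a (k + l + m))
    ≡⟨ cong (filter P?) (trans (interval-++ a (k + l) m) (cong (_++ interval (a + (k + l)) m) (interval-++ a k l))) ⟩
  filter P? ((interval a k ++ interval (a + k) l) ++ interval (a + (k + l)) m)
    ≡⟨ trans (filter-++ P? (interval a k ++ interval (a + k) l) (interval (a + (k + l)) m))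
             (cong (_++ filter P? (interval (a + (k + l)) m)) (filter-++ P? (interval a k) (interval (a + k) l))) ⟩
  (filter P? (interval a k) ++ filter P? (interval (a + k) l)) ++ filter P? (interval (a + (k + l)) m)
    ≡⟨ cong₂ (λ xs ys → (xs ++ filter P? (interval (a + k) l)) ++ ys)
             (filter-none P? (All-interval⁺ before))
             (filter-none P? (All-interval⁺ (λ w le lt → after w (subst (_≤ w) (sym (+-assoc a k l)) le)
                                                         (subst (w <_) (cong (_+ m) (sym (+-assoc a k l))) lt)))) ⟩
  filter P? (interval (a + k) l) ++ []
    ≡⟨ ++-identityʳ (filter P? (interval (a + k) l)) ⟩
  filter P? (interval (a + k) l) ∎

module _ {p} {P : Pred ℕ p} (P? : Decidable P) where

  IsLastIn : ℕ → ℕ → ℕ → Set p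
  IsLastIn a k v = a ≤ v × v < a + k × P v × (∀ w → v < w → w < a + k → ¬ P w)

  private
    last-filter-accept : ∀ a k → P (a + k) → last (filter P? (interval a (suc k))) ≡ just (a + k)
    last-filter-accept a k pk = begin
      last (filter P? (interval a (suc k)))       ≡⟨ cong (last ∘ filter P?) (interval-∷ʳ a k) ⟩
      last (filter P? (interval a k ++ [ a + k ])) ≡⟨ cong last (filter-++ P? (interval a k) [ a + k ]) ⟩
      last (filter P? (interval a k) ++ filter P? [ a + k ])
        ≡⟨ cong (λ ys → last (filter P? (interval a k) ++ ys)) (filter-accept P? pk) ⟩
      last (filter P? (interval a k) ++ [ a + k ]) ≡⟨ last-∷ʳ (filter P? (interval a k)) (a + k) ⟩
      just (a + k) ∎

    last-filter-reject : ∀ a k → ¬ P (a + k) → last (filter P? (interval a (suc k))) ≡ last (filter P? (interval a k))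
    last-filter-reject a k ¬pk = begin
      last (filter P? (interval a (suc k)))       ≡⟨ cong (last ∘ filter P?) (interval-∷ʳ a k) ⟩
      last (filter P? (interval a k ++ [ a + k ])) ≡⟨ cong last (filter-++ P? (interval a k) [ a + k ]) ⟩
      last (filter P? (interval a k) ++ filter P? [ a + k ])
        ≡⟨ cong (λ ys → last (filter P? (interval a k) ++ ys)) (filter-reject P? ¬pk) ⟩
      last (filter P? (interval a k) ++ [])        ≡⟨ cong last (++-identityʳ (filter P? (interval a k))) ⟩
      last (filter P? (interval a k)) ∎

    a+k<a+1+k : ∀ a k → a + k < a + suc k
    a+k<a+1+k a k = +-monoʳ-< a (n<1+n k)

  last-filter-interval⇒ : ∀ a k v → last (filter P? (interval a k)) ≡ just v → IsLastIn a k v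
  last-filter-interval⇒ a zero    v ()
  last-filter-interval⇒ a (suc k) v e with P? (a + k)
  ... | yes pk with trans (sym (last-filter-accept a k pk)) e
  ... | refl = m≤m+n a k , a+k<a+1+k a k , pk ,
               λ w v<w w< → ⊥-elim (<⇒≱ v<w (≤-pred (subst (w <_) (+-suc a k) w<)))
  last-filter-interval⇒ a (suc k) v e | no ¬pk
    with last-filter-interval⇒ a k v (trans (sym (last-filter-reject a k ¬pk)) e)
  ... | a≤v , v< , pv , none-after = a≤v , <-trans v< (a+k<a+1+k a k) , pv , none-after′
    where
    none-after′ : ∀ w → v < w → w < a + suc k → ¬ P w
    none-after′ w v<w w< with below-next {a} {k} w<
    ... | inj₁ w<a+k = none-after w v<w w<a+k
    ... | inj₂ refl  = ¬pk

  last-filter-interval⇐ : ∀ a k v → IsLastIn a k v → last (filter P? (interval a k)) ≡ just v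
  last-filter-interval⇐ a zero    v (a≤v , v< , _) = ⊥-elim (<⇒≱ (subst (v <_) (+-identityʳ a) v<) a≤v)
  last-filter-interval⇐ a (suc k) v (a≤v , v< , pv , none-after) with below-next {a} {k} v<
  ... | inj₂ refl = last-filter-accept a k pv
  ... | inj₁ v<a+k = trans (last-filter-reject a k (none-after (a + k) v<a+k (a+k<a+1+k a k)))
    (last-filter-interval⇐ a k v (a≤v , v<a+k , pv , λ w v<w w< → none-after w v<w (<-trans w< (a+k<a+1+k a k))))

least : ∀ {p} {P : Pred ℕ p} → Decidable P → ∀ {m} → P m → ∃ λ i → i ≤ m × P i × (∀ j → j < i → ¬ P j)
least P? {m} pm with P? 0
... | yes p0 = 0 , z≤n , p0 , λ j ()
least P? {zero}  pm | no ¬p0 = ⊥-elim (¬p0 pm)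
least {P = P} P? {suc m} pm | no ¬p0 with least (P? ∘ suc) {m} pm
... | i , i≤m , pi , below-i = suc i , s≤s i≤m , pi , none-below
  where
  none-below : ∀ j → j < suc i → ¬ P j
  none-below zero    _         = ¬p0
  none-below (suc j) (s≤s j<i) = below-i j j<i

climb : (f : ℕ → ℕ) {m : ℕ} → (∀ i → suc i ≤ m → f (suc i) ≤ suc (f i)) →
  ∀ {e u h} → e ≤ u → u ≤ m → f e ≤ h → h < f u → ∃ λ q → e ≤ q × q < u × f q ≡ h
climb f slow {u = zero}  z≤n _ fe≤h h<fu = ⊥-elim (<⇒≱ h<fu fe≤h)
climb f slow {e} {suc u} {h} e≤u u≤m fe≤h h<fu with m≤n⇒m<n∨m≡n e≤u
... | inj₂ refl = ⊥-elim (<⇒≱ h<fu fe≤h)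
... | inj₁ e<1+u with f u ≟ h
...   | yes fu≡h = u , ≤-pred e<1+u , n<1+n u , fu≡h
...   | no fu≢h with climb f slow (≤-pred e<1+u) (<⇒≤ u≤m) fe≤h
                      (≤∧≢⇒< (≤-pred (≤-trans h<fu (slow u u≤m))) (fu≢h ∘ sym))
...     | q , e≤q , q<u , fq≡h = q , e≤q , <-trans q<u (n<1+n u) , fq≡h

at-0 : ∀ xs → at xs 0 ≡ 0
at-0 []       = refl
at-0 (x ∷ xs) = refl

at-positions : ∀ xs → map (at xs) (interval 1 (length xs)) ≡ xs
at-positions []       = refl
at-positions (x ∷ xs) = cong (x ∷_) (trans (shift 0 (length xs)) (at-positions xs))
  where
  shift : ∀ a m → map (at (x ∷ xs)) (interval (suc (suc a)) m) ≡ map (at xs) (interval (suc a) m)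
  shift a zero    = refl
  shift a (suc m) = cong (at xs (suc a) ∷_) (shift (suc a) m)

Any⇒position : ∀ {p} {P : Pred ℕ p} xs → Any P xs → ∃ λ u → 1 ≤ u × u ≤ length xs × P (at xs u)
Any⇒position (x ∷ xs) (here px) = 1 , s≤s z≤n , s≤s z≤n , px
Any⇒position (x ∷ xs) (there pxs) with Any⇒position xs pxs
... | suc u , _ , u≤ , pu = suc (suc u) , s≤s z≤n , s≤s u≤ , pu

position⇒Any : ∀ {p} {P : Pred ℕ p} xs u → 1 ≤ u → u ≤ length xs → P (at xs u) → Any P xs
position⇒Any (x ∷ xs) (suc zero)    _ _        pu = here pu
position⇒Any (x ∷ xs) (suc (suc u)) _ (s≤s u≤) pu = there (position⇒Any xs (suc u) (s≤s z≤n) u≤ pu)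

≤-maxEntry : ∀ xs x → Any (_≡ x) xs → x ≤ maxEntry xs
≤-maxEntry (y ∷ xs) x (here refl) = m≤m⊔n y (maxEntry xs)
≤-maxEntry (y ∷ xs) x (there x∈) = ≤-trans (≤-maxEntry xs x x∈) (m≤n⊔m y (maxEntry xs))

lastWith-just : ∀ xs k m {c} → lastWith xs k m ≡ just c →
  1 ≤ c × c ≤ m × at xs c ≡ k × (∀ q → c < q → q ≤ m → at xs q ≢ k)
lastWith-just xs k zero    ()
lastWith-just xs k (suc m) e with at xs (suc m) ≟ k
lastWith-just xs k (suc m) refl | yes am≡k = s≤s z≤n , ≤-refl , am≡k , λ q c<q q≤ → ⊥-elim (<⇒≱ c<q q≤)
... | no am≢k with lastWith-just xs k m e
... | 1≤c , c≤m , ac≡k , none-after = 1≤c , m≤n⇒m≤1+n c≤m , ac≡k , none-after′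
  where
  none-after′ : ∀ q → _ < q → q ≤ suc m → at xs q ≢ k
  none-after′ q c<q q≤ with m≤n⇒m<n∨m≡n q≤
  ... | inj₁ q<1+m = none-after q c<q (≤-pred q<1+m)
  ... | inj₂ refl  = am≢k

lastWith-complete : ∀ xs k m {q} → 1 ≤ q → q ≤ m → at xs q ≡ k → ∃ λ c → lastWith xs k m ≡ just c
lastWith-complete xs k zero    1≤q q≤ aq = ⊥-elim (<⇒≱ 1≤q q≤)
lastWith-complete xs k (suc m) {q} 1≤q q≤ aq with at xs (suc m) ≟ k
... | yes _ = suc m , refl
... | no am≢k with m≤n⇒m<n∨m≡n q≤
...   | inj₁ q<1+m = lastWith-complete xs k m 1≤q (≤-pred q<1+m) aq
...   | inj₂ refl  = ⊥-elim (am≢k aq)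

module AreaTree (as : List ℕ) (a₁≡0 : at as 1 ≡ 0)
                (climbs-slowly : ∀ i → 1 ≤ i → suc i ≤ length as → at as (suc i) ≤ suc (at as i)) where

  n : ℕ
  n = length as

  A : ℕ → ℕ
  A = at as

  -- The level of a vertex is its generation plus one, so that the root has level 0.
  ℓ : ℕ → ℕ
  ℓ zero    = 0
  ℓ (suc i) = suc (A (suc i))

  ℓ-slow : ∀ i → suc i ≤ n → ℓ (suc i) ≤ suc (ℓ i)
  ℓ-slow zero    _  = s≤s (≤-reflexive a₁≡0)
  ℓ-slow (suc i) le = s≤s (climbs-slowly (suc i) (s≤s z≤n) le)

  ℓ-positive : ∀ {u} → 1 ≤ u → ℓ u ≡ suc (A u)
  ℓ-positive {suc u} _ = refl

  level-shift : ∀ {u v} → 1 ≤ u → 1 ≤ v → ∀ d → (ℓ u ≡ d + ℓ v) ⇔ (A u ≡ d + A v)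
  level-shift {suc u} {suc v} _ _ d =
    mk⇔ (λ e → suc-injective (trans e (+-suc d _))) (λ e → trans (cong suc e) (sym (+-suc d _)))

  same-generation : ∀ v w → (generation as w ≡ generation as v) ⇔ (ℓ w ≡ ℓ v)
  same-generation zero    zero    = mk⇔ (λ _ → refl) (λ _ → refl)
  same-generation zero    (suc w) = mk⇔ (λ ()) (λ ())
  same-generation (suc v) zero    = mk⇔ (λ ()) (λ ())
  same-generation (suc v) (suc w) = mk⇔ (cong suc ∘ ℤ.+-injective) (cong ℤ.+_ ∘ suc-injective)

  -- Any occurrence of k+1 is preceded by an occurrence of k (levels cannot jump up).
  earlier-occurrence : ∀ {u k} → 1 ≤ u → u ≤ n → A u ≡ suc k → ∃ λ q → 1 ≤ q × q < u × A q ≡ k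
  earlier-occurrence {u} {k} 1≤u u≤n au
    with climb ℓ ℓ-slow {h = suc k} 1≤u u≤n (s≤s (subst (_≤ k) (sym a₁≡0) z≤n))
                                          (subst (suc k <_) (sym (ℓ-positive 1≤u)) (s≤s (≤-reflexive (sym au))))
  ... | suc q , _ , q<u , ℓq = suc q , s≤s z≤n , q<u , suc-injective ℓq

  LastOccurrence : ℕ → ℕ → Set
  LastOccurrence k c = 1 ≤ c × c ≤ n × A c ≡ k × (∀ q → c < q → q ≤ n → A q ≢ k)

  last-occurrence : ∀ {q k} → 1 ≤ q → q ≤ n → A q ≡ k → ∃ (LastOccurrence k)
  last-occurrence {q} {k} 1≤q q≤n aq with lastWith-complete as k n 1≤q q≤n aq
  ... | c , lw≡c = c , lastWith-just as k n lw≡c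

  IsParent : ℕ → ℕ → Set
  IsParent p u = p < u × ℓ u ≡ suc (ℓ p) × (∀ q → p < q → q < u → ℓ q ≢ ℓ p)

  parent-sound : ∀ {p u} → parent as u ≡ just p → IsParent p u
  parent-sound {p} {suc i} e with at as (suc i) in eq
  parent-sound {p} {suc i} refl | zero = z<s , refl , λ { (suc q) _ _ () }
  ... | suc k with lastWith-just as k i e
  ... | 1≤p , p≤i , ap , none-after = s≤s p≤i , cong suc (trans (cong suc (sym ap)) (sym (ℓ-positive 1≤p))) , not-level
    where
    not-level : ∀ q → p < q → q < suc i → ℓ q ≢ ℓ p
    not-level (suc q) p<q q< ℓq≡ℓp =
      none-after (suc q) p<q (≤-pred q<) (suc-injective (trans ℓq≡ℓp (trans (ℓ-positive 1≤p) (cong suc ap))))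

  -- Every non-root vertex has a parent: for aᵤ = k+1 some earlier position holds k.
  parent-exists : ∀ {u} → 1 ≤ u → u ≤ n → ∃ λ p → parent as u ≡ just p
  parent-exists {suc i} 1≤u u≤n with at as (suc i) in eq
  ... | zero  = 0 , refl
  ... | suc k with earlier-occurrence 1≤u u≤n eq
  ...   | q , 1≤q , q<u , aq with lastWith-complete as k i 1≤q (≤-pred q<u) aq
  ...     | p , lw≡p = p , lw≡p

  IsParent-unique : ∀ {p p′ u} → IsParent p u → IsParent p′ u → p ≡ p′
  IsParent-unique {p} {p′} (p<u , ℓu , gap) (p′<u , ℓu′ , gap′) with <-cmp p p′
  ... | tri≈ _ p≡p′ _ = p≡p′
  ... | tri< p<p′ _ _ = ⊥-elim (gap p′ p<p′ p′<u (suc-injective (trans (sym ℓu′) ℓu)))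
  ... | tri> _ _ p′<p = ⊥-elim (gap′ p p′<p p<u (suc-injective (trans (sym ℓu) ℓu′)))

  parent-complete : ∀ {p u} → u ≤ n → IsParent p u → parent as u ≡ just p
  parent-complete {p} {u} u≤n isParent with parent-exists (≤-trans (s≤s z≤n) (proj₁ isParent)) u≤n
  ... | p′ , pu≡p′ = trans pu≡p′ (cong just (IsParent-unique (parent-sound pu≡p′) isParent))

  child? : (v : ℕ) → Decidable (λ w → parent as w ≡ just v)
  child? v w = MaybeP.≡-dec _≟_ (parent as w) (just v)

  ∈-children : ∀ {u v} → (u ∈ children as v) ⇔ (u ≤ n × parent as u ≡ just v)
  ∈-children {u} {v} = mk⇔ (λ u∈ → let u∈V , pu = ∈-filter⁻ (child? v) {xs = vertices as} u∈ in ≤-pred (∈-upTo⁻ u∈V) , pu)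
                           (λ (u≤n , pu) → ∈-filter⁺ (child? v) (∈-upTo⁺ (s≤s u≤n)) pu)

  has-child⇔ : ∀ {v} → (0 < length (children as v)) ⇔ (∃ λ u → u ≤ n × parent as u ≡ just v)
  has-child⇔ {v} = mk⇔ (λ nonempty → let u , u∈ = element nonempty in u , to ∈-children u∈)
                       (λ (u , u≤n , pu) → filter-some (child? v) (lose (∈-upTo⁺ (s≤s u≤n)) pu))
    where
    element : ∀ {xs : List ℕ} → 0 < length xs → ∃ λ x → x ∈ xs
    element {x ∷ _} _ = x , here refl

  childless⇔ : ∀ {v} → (children as v ≡ []) ⇔ (∀ u → u ≤ n → parent as u ≢ just v)
  childless⇔ {v} = mk⇔ (λ none u u≤n pu → ¬Any[] (subst (u ∈_) none (from ∈-children (u≤n , pu))))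
                       (λ none → filter-none (child? v) (All.tabulate (λ u∈ → none _ (≤-pred (∈-upTo⁻ u∈)))))

  -- [v, e) is the vertex set of the subtree of v: the vertices after v and before e
  -- are deeper than v, and e is past the last vertex or no deeper than v.
  record SubtreeSpan (v e : ℕ) : Set where
    field
      v<e      : v < e
      e≤1+n    : e ≤ suc n
      deeper   : ∀ u → v < u → u < e → ℓ v < ℓ u
      boundary : e ≡ suc n ⊎ ℓ e ≤ ℓ v

  root-span : SubtreeSpan 0 (suc n)
  root-span = record { v<e = z<s ; e≤1+n = ≤-refl ; deeper = λ { (suc u) _ _ → z<s } ; boundary = inj₁ refl }

  child-in-span : ∀ {v e u} → SubtreeSpan v e → u ≤ n → parent as u ≡ just v → u < e
  child-in-span {v} {e} {u} span u≤n pu with u <? e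
  ... | yes u<e = u<e
  ... | no u≮e with SubtreeSpan.boundary span | parent-sound pu
  ...   | inj₁ refl  | _ = ⊥-elim (u≮e (s≤s u≤n))
  ...   | inj₂ ℓe≤ℓv | v<u , ℓu , gap with climb ℓ ℓ-slow (≮⇒≥ u≮e) u≤n ℓe≤ℓv (≤-reflexive (sym ℓu))
  ...     | q , e≤q , q<u , ℓq = ⊥-elim (gap q (<-≤-trans (SubtreeSpan.v<e span) e≤q) q<u ℓq)

  span-child : ∀ {v e u} → SubtreeSpan v e → v < u → u < e → ℓ u ≡ suc (ℓ v) → parent as u ≡ just v
  span-child span v<u u<e ℓu = parent-complete (≤-pred (<-≤-trans u<e (SubtreeSpan.e≤1+n span)))
    (v<u , ℓu , λ q v<q q<u → >⇒≢ (SubtreeSpan.deeper span q v<q (<-trans q<u u<e)))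

  children-in-span : ∀ {v k} → SubtreeSpan v (v + suc k) → children as v ≡ filter (child? v) (interval (suc v) k)
  children-in-span {v} {k} span with m≤n⇒∃[o]m+o≡n (SubtreeSpan.e≤1+n span)
  ... | r , e+r≡1+n = begin
    children as v
      ≡⟨ cong (filter (child? v)) (upTo≡interval (suc n)) ⟩
    filter (child? v) (interval 0 (suc n))
      ≡⟨ cong (filter (child? v) ∘ interval 0) (sym total) ⟩
    filter (child? v) (interval 0 (suc v + k + r))
      ≡⟨ filter-middle (child? v) 0 (suc v) k r before-v after-span ⟩
    filter (child? v) (interval (suc v) k) ∎
    where
    total : suc v + k + r ≡ suc n
    total = trans (cong (_+ r) (sym (+-suc v k))) e+r≡1+n
    before-v : ∀ w → 0 ≤ w → w < suc v → parent as w ≢ just v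
    before-v w _ w<1+v pw = <⇒≱ (proj₁ (parent-sound pw)) (≤-pred w<1+v)
    after-span : ∀ w → suc v + k ≤ w → w < suc v + k + r → parent as w ≢ just v
    after-span w e≤w w< pw =
      <⇒≱ (child-in-span span (≤-pred (subst (w <_) total w<)) pw) (subst (_≤ w) (sym (+-suc v k)) e≤w)

  Stop : ℕ → ℕ → ℕ → Set
  Stop s e c = (s < c × c < e × ℓ c ≤ ℓ s) ⊎ c ≡ e

  stop? : ∀ s e → Decidable (Stop s e)
  stop? s e c = ((s <? c) ×-dec ((c <? e) ×-dec (ℓ c ≤? ℓ s))) ⊎-dec (c ≟ e)

  stop-after-start : ∀ {s e c} → s < e → Stop s e c → s < c
  stop-after-start s<e (inj₁ (s<c , _)) = s<c
  stop-after-start s<e (inj₂ refl)      = s<e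

  record ChildBlock (v e s : ℕ) : Set where
    field
      len        : ℕ
      span       : SubtreeSpan s (s + suc len)
      within     : s + suc len ≤ e
      sole-child : filter (child? v) (interval s (suc len)) ≡ [ s ]
      next       : s + suc len ≡ e ⊎ ℓ (s + suc len) ≡ suc (ℓ v)

  -- The subtree of a child s of v ends at the first later vertex no deeper than s.
  child-block : ∀ {v e s} → SubtreeSpan v e → v < s → s < e → ℓ s ≡ suc (ℓ v) → ChildBlock v e s
  child-block {v} {e} {s} span v<s s<e ℓs with least (stop? s e) {e} (inj₂ refl)
  ... | c , c≤e , stop-c , no-earlier-stop with m≤n⇒∃[o]m+o≡n (stop-after-start s<e stop-c)
  ... | j , 1+s+j≡c with trans (+-suc s j) 1+s+j≡c
  ... | refl = record { len = j ; span = block-span ; within = c≤e ; sole-child = sole ; next = next-child stop-c }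
    where
    open SubtreeSpan span
    ℓv≤ℓs : ℓ v ≤ ℓ s
    ℓv≤ℓs = ≤-trans (n≤1+n (ℓ v)) (≤-reflexive (sym ℓs))
    block-span : SubtreeSpan s (s + suc j)
    block-span = record
      { v<e      = m<m+n s z<s
      ; e≤1+n    = ≤-trans c≤e e≤1+n
      ; deeper   = λ u s<u u<c → ≰⇒> (λ ℓu≤ℓs → no-earlier-stop u u<c (inj₁ (s<u , <-≤-trans u<c c≤e , ℓu≤ℓs)))
      ; boundary = block-boundary stop-c }
      where
      block-boundary : Stop s e (s + suc j) → s + suc j ≡ suc n ⊎ ℓ (s + suc j) ≤ ℓ s
      block-boundary (inj₁ (_ , _ , ℓc≤ℓs)) = inj₂ ℓc≤ℓs
      block-boundary (inj₂ refl) with boundary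
      ... | inj₁ e≡1+n  = inj₁ e≡1+n
      ... | inj₂ ℓe≤ℓv  = inj₂ (≤-trans ℓe≤ℓv ℓv≤ℓs)
    sole : filter (child? v) (interval s (suc j)) ≡ [ s ]
    sole = trans (filter-accept (child? v) (span-child span v<s s<e ℓs))
                 (cong (s ∷_) (filter-none (child? v) (All-interval⁺ {a = suc s} {k = j} not-child)))
      where
      not-child : ∀ u → suc s ≤ u → u < suc s + j → parent as u ≢ just v
      not-child u s<u u< pu = >⇒≢ (SubtreeSpan.deeper block-span u s<u (subst (u <_) (sym (+-suc s j)) u<))
                                  (trans (proj₁ (proj₂ (parent-sound pu))) (sym ℓs))
    next-child : Stop s e (s + suc j) → s + suc j ≡ e ⊎ ℓ (s + suc j) ≡ suc (ℓ v)
    next-child (inj₂ c≡e)             = inj₁ c≡e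
    next-child (inj₁ (s<c , c<e , ℓc≤ℓs)) =
      inj₂ (≤-antisym (≤-trans ℓc≤ℓs (≤-reflexive ℓs)) (deeper (s + suc j) (<-trans v<s s<c) c<e))

  PreorderOnSpans : ℕ → Set
  PreorderOnSpans f = ∀ s j → SubtreeSpan s (s + suc j) → suc j ≤ f → preorderF as f s ≡ interval s (suc j)

  forest : ∀ {f v e} → PreorderOnSpans f → SubtreeSpan v e →
    ∀ {s} m → Acc _<_ m → s + m ≡ e → v < s → (m ≡ 0 ⊎ ℓ s ≡ suc (ℓ v)) → m ≤ f →
    concatMap (preorderF as f) (filter (child? v) (interval s m)) ≡ interval s m
  forest traversal span zero    _ _ _ _ _ = refl
  forest traversal span (suc m) _ _ _ (inj₁ ()) _
  forest {f} {v} {e} traversal span {s} (suc m) (acc smaller) s+m≡e v<s (inj₂ ℓs) m≤f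
    with child-block span v<s (subst (s <_) s+m≡e (m<m+n s z<s)) ℓs
  ... | record { len = len ; span = block-span ; within = within ; sole-child = sole ; next = next }
    with m≤n⇒∃[o]m+o≡n within
  ... | rest , c+rest≡e
    with suc-injective (+-cancelˡ-≡ s (suc m) (suc len + rest)
                         (trans s+m≡e (trans (sym c+rest≡e) (+-assoc s (suc len) rest))))
  ... | refl = begin
    concatMap τ (filter (child? v) (interval s (suc len + rest)))
      ≡⟨ cong (concatMap τ ∘ filter (child? v)) (interval-++ s (suc len) rest) ⟩
    concatMap τ (filter (child? v) (interval s (suc len) ++ interval c rest))
      ≡⟨ cong (concatMap τ) (filter-++ (child? v) (interval s (suc len)) (interval c rest)) ⟩
    concatMap τ (filter (child? v) (interval s (suc len)) ++ filter (child? v) (interval c rest))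
      ≡⟨ cong (λ xs → concatMap τ (xs ++ filter (child? v) (interval c rest))) sole ⟩
    τ s ++ concatMap τ (filter (child? v) (interval c rest))
      ≡⟨ cong₂ _++_ (traversal s len block-span (≤-trans (s≤s (m≤m+n len rest)) m≤f))
                    (forest traversal span rest (smaller (s≤s (m≤n+m rest len))) c+rest≡e
                            (<-trans v<s (m<m+n s z<s)) (rest-starts-at-child next) (≤-trans (m≤n+m rest (suc len)) m≤f)) ⟩
    interval s (suc len) ++ interval c rest
      ≡⟨ sym (interval-++ s (suc len) rest) ⟩
    interval s (suc len + rest) ∎
    where
    τ = preorderF as f
    c = s + suc len
    rest-starts-at-child : c ≡ e ⊎ ℓ c ≡ suc (ℓ v) → rest ≡ 0 ⊎ ℓ c ≡ suc (ℓ v)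
    rest-starts-at-child (inj₁ c≡e) = inj₁ (+-cancelˡ-≡ c rest 0 (trans c+rest≡e (trans (sym c≡e) (sym (+-identityʳ c)))))
    rest-starts-at-child (inj₂ ℓc) = inj₂ ℓc

  preorder-on-spans : ∀ f → PreorderOnSpans f
  preorder-on-spans zero    s j span ()
  preorder-on-spans (suc f) s j span (s≤s j≤f) = cong (s ∷_) (begin
    concatMap (preorderF as f) (children as s)
      ≡⟨ cong (concatMap (preorderF as f)) (children-in-span span) ⟩
    concatMap (preorderF as f) (filter (child? s) (interval (suc s) j))
      ≡⟨ forest (preorder-on-spans f) span j (<-wellFounded j) (sym (+-suc s j)) (n<1+n s) (first-child j span) j≤f ⟩
    interval (suc s) j ∎)
    where
    first-child : ∀ j → SubtreeSpan s (s + suc j) → j ≡ 0 ⊎ ℓ (suc s) ≡ suc (ℓ s)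
    first-child zero     _    = inj₁ refl
    first-child (suc j′) span = inj₂ (≤-antisym (ℓ-slow s (≤-pred (<-≤-trans 1+s<e e≤1+n))) (deeper (suc s) (n<1+n s) 1+s<e))
      where
      open SubtreeSpan span
      1+s<e : suc s < s + suc (suc j′)
      1+s<e = subst (suc s <_) (sym (+-suc s (suc j′))) (s<s (m<m+n s z<s))

  birthOrder≡vertices : birthOrder as ≡ interval 0 (suc n)
  birthOrder≡vertices = preorder-on-spans (suc n) 0 n root-span ≤-refl

  LastOfLevel : ℕ → Set
  LastOfLevel v = ∀ w → v < w → w ≤ n → ℓ w ≢ ℓ v

  -- Since birth order is label order, the youngest member of a generation is its largest label.
  youngest⇔ : ∀ {v} → v ≤ n → Youngest as v ⇔ LastOfLevel v
  youngest⇔ {v} v≤n = mk⇔ youngest⇒ youngest⇐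
    where
    same? : Decidable (λ w → generation as w ≡ generation as v)
    same? w = generation as w ℤ.≟ generation as v
    members : generationMembers as v ≡ filter same? (interval 0 (suc n))
    members = cong (filter same?) birthOrder≡vertices
    youngest⇒ : Youngest as v → LastOfLevel v
    youngest⇒ youngest w v<w w≤n ℓw≡ℓv with last-filter-interval⇒ same? 0 (suc n) v (trans (sym (cong last members)) youngest)
    ... | _ , _ , _ , none-after = none-after w v<w (s≤s w≤n) (from (same-generation v w) ℓw≡ℓv)
    youngest⇐ : LastOfLevel v → Youngest as v
    youngest⇐ is-last = trans (cong last members) (last-filter-interval⇐ same? 0 (suc n) v
      (z≤n , s≤s v≤n , refl , λ w v<w w< same → is-last w v<w (≤-pred w<) (to (same-generation v w) same)))

  Separation : ℕ → Set
  Separation k = (∃ λ u → 1 ≤ u × u ≤ n × A u ≡ suc k)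
               × (∀ j l → 1 ≤ j → j ≤ n → 1 ≤ l → l ≤ n → A j ≡ k → A l ≡ suc k → j < l)

  separated⇔ : ∀ k → Separated as k ⇔ Separation k
  separated⇔ k = mk⇔
    (λ (occurs , ordered) → Any⇒position as occurs ,
      λ j l 1≤j j≤n 1≤l l≤n → All-positions⁻ n (All-positions⁻ n ordered j 1≤j j≤n) l 1≤l l≤n)
    (λ ((u , 1≤u , u≤n , au) , ordered) → position⇒Any as u 1≤u u≤n au ,
      All-positions⁺ n (λ j 1≤j j≤n → All-positions⁺ n (λ l 1≤l l≤n → ordered j l 1≤j j≤n 1≤l l≤n)))

  crucial⇒ : ∀ {v} → 1 ≤ v → v ≤ n → Crucial as v → LastOfLevel v × Separation (A v)
  crucial⇒ {v} 1≤v v≤n (youngest , has-child , others-childless) = is-last , occurs , ordered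
    where
    is-last : LastOfLevel v
    is-last = to (youngest⇔ v≤n) youngest
    occurs : ∃ λ u → 1 ≤ u × u ≤ n × A u ≡ suc (A v)
    occurs with to has-child⇔ has-child
    ... | u , u≤n , pu = u , 1≤u , u≤n , to (level-shift 1≤u 1≤v 1) (proj₁ (proj₂ (parent-sound pu)))
      where 1≤u = ≤-trans 1≤v (<⇒≤ (proj₁ (parent-sound pu)))
    -- the parent w of an occurrence l of A v + 1 is at the level of v; it is v or another
    -- vertex of that level, which is childless
    ordered : ∀ j l → 1 ≤ j → j ≤ n → 1 ≤ l → l ≤ n → A j ≡ A v → A l ≡ suc (A v) → j < l
    ordered j l 1≤j j≤n 1≤l l≤n aj al with j <? l
    ... | yes j<l = j<l
    ... | no j≮l with parent-exists 1≤l l≤n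
    ...   | w , pl with parent-sound pl
    ...     | w<l , ℓl , _ with w ≟ v
    ...       | yes refl = ⊥-elim (is-last j (<-≤-trans w<l (≮⇒≥ j≮l)) j≤n (from (level-shift 1≤j 1≤v 0) aj))
    ...       | no w≢v = ⊥-elim (to childless⇔ (All.lookup others-childless w∈V w≢v (from (same-generation v w) ℓw≡ℓv)) l l≤n pl)
      where
      w∈V = ∈-upTo⁺ (s≤s (≤-trans (<⇒≤ w<l) l≤n))
      ℓw≡ℓv = suc-injective (trans (sym ℓl) (from (level-shift 1≤l 1≤v 1) al))

  -- Conversely, the child of v is the first occurrence u of aᵥ + 1, and another vertex of the
  -- level of v with a child would precede v while its child follows v.
  crucial⇐ : ∀ {v} → 1 ≤ v → v ≤ n → LastOfLevel v → Separation (A v) → Crucial as v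
  crucial⇐ {v} 1≤v v≤n is-last ((u , 1≤u , u≤n , au) , ordered) =
    from (youngest⇔ v≤n) is-last , from has-child⇔ (u , u≤n , pu) , All.tabulate others-childless
    where
    v<u = ordered v u 1≤v v≤n 1≤u u≤n refl au
    pu : parent as u ≡ just v
    pu = parent-complete u≤n (v<u , from (level-shift 1≤u 1≤v 1) au , λ q v<q q<u → is-last q v<q (≤-trans (<⇒≤ q<u) u≤n))
    -- a child x of another vertex w of the level of v is an occurrence of A v + 1, so
    -- w < v < x would put v between a parent and its child
    no-other-parent : ∀ {w x} → w ≢ v → ℓ w ≡ ℓ v → x ≤ n → parent as x ≢ just w
    no-other-parent {w} {x} w≢v ℓw≡ℓv x≤n px with parent-sound px | <-cmp w v
    ... | _ | tri≈ _ w≡v _ = w≢v w≡v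
    ... | w<x , _ , _ | tri> _ _ v<w = is-last w v<w (≤-trans (<⇒≤ w<x) x≤n) ℓw≡ℓv
    ... | w<x , ℓx , gap | tri< w<v _ _ = gap v w<v v<x (sym ℓw≡ℓv)
      where
      1≤x = ≤-trans (s≤s z≤n) w<x
      v<x = ordered v x 1≤v v≤n 1≤x x≤n refl (to (level-shift 1≤x 1≤v 1) (trans ℓx (cong suc ℓw≡ℓv)))
    others-childless : ∀ {w} → w ∈ vertices as → w ≢ v → generation as w ≡ generation as v → children as w ≡ []
    others-childless {w} _ w≢v same = from childless⇔ (λ x x≤n → no-other-parent w≢v (to (same-generation v w) same) x≤n)

  -- The root is crucial: it is alone in its generation and has the child 1.
  root-crucial : 1 ≤ n → Crucial as 0
  root-crucial 1≤n =
    from (youngest⇔ z≤n) (λ { (suc w) _ _ () }) ,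
    from has-child⇔ (1 , 1≤n , parent-complete 1≤n (z<s , cong suc a₁≡0 , λ q 0<q q<1 → ⊥-elim (<⇒≱ q<1 0<q))) ,
    All.tabulate (λ { {zero} _ 0≢0 _ → ⊥-elim (0≢0 refl) ; {suc w} _ _ () })

  last-occurrence-crucial : ∀ {k c} → LastOccurrence k c → Separation k → Crucial as c
  last-occurrence-crucial {k} {c} (1≤c , c≤n , ac , none-after) sep =
    crucial⇐ 1≤c c≤n is-last (subst Separation (sym ac) sep)
    where
    is-last : LastOfLevel c
    is-last w c<w w≤n ℓw≡ℓc = none-after w c<w w≤n (trans (to (level-shift (≤-trans 1≤c (<⇒≤ c<w)) 1≤c 0) ℓw≡ℓc) ac)

  root-degree : length (children as 0) ≡ numZeros as
  root-degree = begin
    length (children as 0)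
      ≡⟨ cong (length ∘ filter (child? 0)) (upTo≡interval (suc n)) ⟩
    length (filter (child? 0) (interval 0 (suc n)))
      ≡⟨ cong length (filter-reject (child? 0) {x = 0} {xs = interval 1 n} (λ ())) ⟩
    length (filter (child? 0) (interval 1 n))
      ≡⟨ cong length (filter-cong-on (child? 0) (λ w → A w ≟ 0) (All-interval⁺ root-child⇔)) ⟩
    length (filter (λ w → A w ≟ 0) (interval 1 n))
      ≡⟨ sym (length-filter-map (_≟ 0) A (interval 1 n)) ⟩
    length (filter (_≟ 0) (map A (interval 1 n)))
      ≡⟨ cong (length ∘ filter (_≟ 0)) (at-positions as) ⟩
    numZeros as ∎
    where
    root-child⇔ : ∀ w → 1 ≤ w → w < 1 + n → (parent as w ≡ just 0) ⇔ (A w ≡ 0)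
    root-child⇔ w 1≤w w<1+n = mk⇔
      (λ pw → suc-injective (trans (sym (ℓ-positive 1≤w)) (proj₁ (proj₂ (parent-sound pw)))))
      (λ aw → parent-complete (≤-pred w<1+n) (1≤w , trans (ℓ-positive 1≤w) (cong suc aw) , λ { (suc q) _ _ () }))

  -- The crucial vertices holding the value k: the last occurrence of k if k is separated, none otherwise.
  crucial-fibre : ∀ k → length (filter (crucial? as ∩? (λ v → A v ≟ k)) (interval 1 n)) ≡ length (filter (separated? as) [ k ])
  crucial-fibre k with separated? as k
  ... | no ¬sep = cong length (trans (filter-none (crucial? as ∩? (λ v → A v ≟ k))
                    (All-interval⁺ λ v 1≤v v< (cv , av) →
                      ¬sep (subst (Separated as) av (from (separated⇔ (A v)) (proj₂ (crucial⇒ 1≤v (≤-pred v<) cv))))))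
                    (sym (filter-reject (separated? as) ¬sep)))
  ... | yes sep with to (separated⇔ k) sep
  ...   | sep′@((u , 1≤u , u≤n , au) , _) with earlier-occurrence 1≤u u≤n au
  ...     | q , 1≤q , q<u , aq with last-occurrence 1≤q (≤-trans (<⇒≤ q<u) u≤n) aq
  ...       | c , last-c@(1≤c , c≤n , ac , none-after) =
    trans (cong length (filter-cong-on (crucial? as ∩? (λ v → A v ≟ k)) (_≟ c) (All-interval⁺ fibre-is-c)))
          (trans (count-in-interval 1 n c 1≤c (s≤s c≤n)) (sym (cong length (filter-accept (separated? as) sep))))
    where
    fibre-is-c : ∀ v → 1 ≤ v → v < 1 + n → (Crucial as v × A v ≡ k) ⇔ (v ≡ c)
    fibre-is-c v 1≤v v<1+n = mk⇔ is-c (λ { refl → last-occurrence-crucial last-c sep′ , ac })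
      where
      is-c : Crucial as v × A v ≡ k → v ≡ c
      is-c (cv , av) with <-cmp v c
      ... | tri≈ _ v≡c _ = v≡c
      ... | tri< v<c _ _ = ⊥-elim (proj₁ (crucial⇒ 1≤v (≤-pred v<1+n) cv) c v<c c≤n
                                          (from (level-shift 1≤c 1≤v 0) (trans ac (sym av))))
      ... | tri> _ _ c<v = ⊥-elim (none-after v c<v (≤-pred v<1+n) av)

  crucial-count : numCrucialNonRoot as ≡ numSeparated as
  crucial-count = begin
    numCrucialNonRoot as
      ≡⟨ cong (length ∘ filter (crucial? as)) (positions≡interval n) ⟩
    length (filter (crucial? as) (interval 1 n))
      ≡⟨ cong length (filter-cong-on (crucial? as) (crucial? as ∩? (λ v → A v <? maxEntry as)) (All-interval⁺ bounded)) ⟩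
    length (filter (crucial? as ∩? (λ v → A v <? maxEntry as)) (interval 1 n))
      ≡⟨ count-by-fibres (crucial? as) (separated? as) A (interval 1 n) crucial-fibre (maxEntry as) ⟩
    numSeparated as ∎
    where
    -- the entry k of a crucial vertex is below the maximum entry, since k+1 occurs
    bounded : ∀ v → 1 ≤ v → v < 1 + n → Crucial as v ⇔ (Crucial as v × A v < maxEntry as)
    bounded v 1≤v v<1+n = mk⇔ (λ cv → cv , below cv) proj₁
      where
      below : Crucial as v → A v < maxEntry as
      below cv with proj₂ (crucial⇒ 1≤v (≤-pred v<1+n) cv)
      ... | (u , 1≤u , u≤n , au) , _ = ≤-maxEntry as (suc (A v)) (position⇒Any as u 1≤u u≤n au)

  LeftmostHasLater : Set
  LeftmostHasLater = ∀ i → 1 ≤ i → i ≤ n → 0 < A i → (∀ j → 1 ≤ j → j < i → A j ≢ A i) →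
                     ∃ λ i₂ → i < i₂ × i₂ ≤ n × A i₂ ≡ pred (A i)

  -- Under this clause, a crucial non-root vertex v is impossible: the first occurrence of
  -- A v + 1 would be followed by an occurrence of A v.
  only-root-crucial : LeftmostHasLater → ∀ v → v ≤ n → Crucial as v → v ≡ 0
  only-root-crucial _ zero _ _ = refl
  only-root-crucial later (suc v) v≤n cv with proj₂ (crucial⇒ (s≤s z≤n) v≤n cv)
  ... | (u , 1≤u , u≤n , au) , ordered with least (λ i → A i ≟ suc (A (suc v))) au
  ...   | zero , _ , a0 , _ = ⊥-elim (0≢1+n (trans (sym (at-0 as)) a0))
  ...   | suc i , i≤u , ai , first
    with later (suc i) (s≤s z≤n) (≤-trans i≤u u≤n) (subst (0 <_) (sym ai) z<s) (λ j _ j<i aj → first j j<i (trans aj ai))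
  ...     | i₂ , i<i₂ , i₂≤n , ai₂ =
    ⊥-elim (<-asym i<i₂ (ordered i₂ (suc i) (≤-trans (s≤s z≤n) (<⇒≤ i<i₂)) i₂≤n (s≤s z≤n) (≤-trans i≤u u≤n)
                                  (trans ai₂ (cong pred ai)) ai))

  -- Conversely, if only the root is crucial, a leftmost occurrence i of k+1 is followed by
  -- the last occurrence c of k: were c before i, c would be crucial.
  leftmost-has-later : All (λ v → Crucial as v → v ≡ 0) (vertices as) → LeftmostHasLater
  leftmost-has-later only-root i 1≤i i≤n 0<Ai leftmost with A i in ai
  ... | zero  = ⊥-elim (<-irrefl refl 0<Ai)
  ... | suc k with earlier-occurrence 1≤i i≤n ai
  ...   | q , 1≤q , q<i , aq with last-occurrence 1≤q (≤-trans (<⇒≤ q<i) i≤n) aq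
  ...     | c , last-c@(1≤c , c≤n , ac , none-after) with <-cmp i c
  ...       | tri< i<c _ _  = c , i<c , c≤n , ac
  ...       | tri≈ _ refl _ = ⊥-elim (1+n≢n (trans (sym ai) ac))
  ...       | tri> _ _ c<i  = ⊥-elim (<⇒≢ 1≤c (sym (All.lookup only-root (∈-upTo⁺ (s≤s c≤n)) c-crucial)))
    where
    c-crucial : Crucial as c
    c-crucial = last-occurrence-crucial last-c ((i , 1≤i , i≤n , ai) , λ j l _ j≤n 1≤l _ aj al →
      <-≤-trans (≤-<-trans (≮⇒≥ (λ c<j → none-after j c<j j≤n aj)) c<i) (≮⇒≥ (λ l<i → leftmost l 1≤l l<i al)))

  propertyC⇔ : 1 ≤ n → PropertyC as ⇔ RootUniqueCrucial as
  propertyC⇔ 1≤n = mk⇔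
    (λ (_ , _ , later) → root-crucial 1≤n , All.tabulate (λ v∈ → only-root-crucial later _ (≤-pred (∈-upTo⁻ v∈))))
    (λ (_ , only-root) → a₁≡0 , climbs-slowly , leftmost-has-later only-root)

length-areaseqFrom : ∀ i x w → length (areaseqFrom i x w) ≡ #N w
length-areaseqFrom i x []      = refl
length-areaseqFrom i x (N ∷ w) = cong suc (length-areaseqFrom (suc i) x w)
length-areaseqFrom i x (E ∷ w) = length-areaseqFrom i (suc x) w

areaseq-head : ∀ x w → at (areaseqFrom 0 x w) 1 ≡ 0
areaseq-head x []      = refl
areaseq-head x (N ∷ w) = 0∸n≡0 x
areaseq-head x (E ∷ w) = areaseq-head (suc x) w

ClimbsSlowlyFrom : ℕ → List ℕ → Set
ClimbsSlowlyFrom p []       = ⊤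
ClimbsSlowlyFrom p (x ∷ xs) = x ≤ suc p × ClimbsSlowlyFrom x xs

suc-∸-≤ : ∀ i x → suc i ∸ x ≤ suc (i ∸ x)
suc-∸-≤ i       zero    = ≤-refl
suc-∸-≤ zero    (suc x) = subst (_≤ 1) (sym (0∸n≡0 x)) z≤n
suc-∸-≤ (suc i) (suc x) = suc-∸-≤ i x

-- An entry i ∸ x is followed by (i+1) ∸ x or, after east steps, by something smaller.
areaseq-climbs : ∀ p i x w → i ∸ x ≤ suc p → ClimbsSlowlyFrom p (areaseqFrom i x w)
areaseq-climbs p i x []      _  = tt
areaseq-climbs p i x (N ∷ w) le = le , areaseq-climbs (i ∸ x) (suc i) x w (suc-∸-≤ i x)
areaseq-climbs p i x (E ∷ w) le = areaseq-climbs p i (suc x) w (≤-trans (∸-monoʳ-≤ i (n≤1+n x)) le)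

climbs-slowly : ∀ p xs → ClimbsSlowlyFrom p xs → ∀ i → 1 ≤ i → suc i ≤ length xs → at xs (suc i) ≤ suc (at xs i)
climbs-slowly p (y ∷ z ∷ zs) (_ , z≤ , _) (suc zero)    _ _         = z≤
climbs-slowly p (y ∷ ys)     (_ , slow)   (suc (suc i)) _ (s≤s le)  = climbs-slowly y ys slow (suc i) (s≤s z≤n) le

mainTheorem2 : (n : ℕ) → 1 ≤ n → (D : List Step) → IsDyck n D →
    (length (children (areaseq D) 0) ≡ numZeros (areaseq D))
    × (numCrucialNonRoot (areaseq D) ≡ numSeparated (areaseq D))
    × (PropertyC (areaseq D) ⇔ RootUniqueCrucial (areaseq D))
mainTheorem2 n 1≤n D (#N≡n , _ , _) = root-degree , crucial-count , propertyC⇔ nonempty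
  where
  open AreaTree (areaseq D) (areaseq-head 0 D) (climbs-slowly 0 (areaseq D) (areaseq-climbs 0 0 0 D z≤n))
    using (root-degree; crucial-count; propertyC⇔)
  nonempty : 1 ≤ length (areaseq D)
  nonempty = subst (1 ≤_) (sym (trans (length-areaseqFrom 0 0 D) #N≡n)) 1≤n
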